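{- Let $S$ be a general position set of a maximal outerplane graph $G$. For any vertex $x\in V(G)$, if $|N_G(x)\cap S|\geq 3$, then $x\notin S$.
   Context: All graphs are finite, simple, undirected and connected. A set $R\subseteq V(G)$ is a general position set of $G$ if no three distinct vertices of $R$ are such that one of them lies on a shortest path (geodesic) in $G$ between the other two. A maximal outerplane graph is a maximal outerplanar graph (an outerplanar graph to which no edge can be added preserving outerplanarity) embedded in the plane with all vertices on the outer face. $N_G(x)$ is the set of neighbours of $x$ in $G$. -}

module Defs where

open import Data.Nat using (ℕ; zero; suc; _+_; _≤_)
open import Data.Fin using (Fin) renaming (_<_ to _<ᶠ_)
open import Data.Fin.Subset using (Subset; _∈_)
open import Data.Bool using (Bool; true; false)
open import Data.Vec using (tabulate)
open import Data.Product using (Σ; ∃; _×_; _,_)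
open import Data.Sum using (_⊎_)
open import Relation.Binary.PropositionalEquality using (_≡_; _≢_)
open import Relation.Nullary using (¬_)
open import Function.Definitions using (Injective)

record Graph (n : ℕ) : Set where
  field
    adj    : Fin n → Fin n → Bool
    sym    : ∀ u v → adj u v ≡ adj v u
    irrefl : ∀ u → adj u u ≡ false

module _ {n : ℕ} (G : Graph n) where
  open Graph G

  Edge : Fin n → Fin n → Set
  Edge u v = adj u v ≡ true

  data Walk : Fin n → Fin n → ℕ → Set where
    []  : ∀ {u} → Walk u u 0
    _∷_ : ∀ {u v w k} → Edge u v → Walk v w k → Walk u w (suc k)

  OnGeodesic : Fin n → Fin n → Fin n → Set
  OnGeodesic w u v =
    Σ ℕ λ a → Σ ℕ λ b → Walk u w a × Walk w v b × (∀ k → Walk u v k → a + b ≤ k)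

  GeneralPosition : Subset n → Set
  GeneralPosition S = ∀ u v w → u ∈ S → v ∈ S → w ∈ S →
    u ≢ v → v ≢ w → u ≢ w → ¬ OnGeodesic w u v

  N : Fin n → Subset n
  N x = tabulate (adj x)

-- Crossing of two chords {p,q} and {r,s} of a convex polygon whose
-- corners are labelled 0,…,n-1 in cyclic order.
Inside : ∀ {n} → Fin n → Fin n → Fin n → Set
Inside p q x = (p <ᶠ x × x <ᶠ q) ⊎ (q <ᶠ x × x <ᶠ p)

Outside : ∀ {n} → Fin n → Fin n → Fin n → Set
Outside p q x = ¬ Inside p q x × x ≢ p × x ≢ q

Cross : ∀ {n} → Fin n → Fin n → Fin n → Fin n → Set
Cross p q r s = (Inside p q r × Outside p q s) ⊎ (Inside p q s × Outside p q r)

-- G is a maximal outerplane graph: there is a placement of the vertices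
-- in cyclic order on the outer face (pos u = position of u on the outer
-- boundary) such that no two edges cross and no edge can be added between
-- distinct non-adjacent vertices without crossing an existing edge.
MaximalOuterplane : ∀ {n} → Graph n → Set
MaximalOuterplane {n} G =
  Σ (Fin n → Fin n) λ pos → Injective _≡_ _≡_ pos ×
    (∀ u v w z → Edge G u v → Edge G w z → ¬ Cross (pos u) (pos v) (pos w) (pos z)) ×
    (∀ u v → u ≢ v → Graph.adj G u v ≡ false →
       Σ (Fin n) λ w → Σ (Fin n) λ z → Edge G w z × Cross (pos u) (pos v) (pos w) (pos z))

{-# OPTIONS --safe #-}
-- If x ∈ S had three neighbours a, b, c in S, they would be pairwise adjacent:
-- otherwise x would lie on the geodesic a–x–b of length 2. So x, a, b, c span a
-- K₄. But four points of a convex polygon, listed in cyclic order p < q < r < s,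
-- have crossing chords pr and qs, so no outerplane graph contains a K₄.
module Submission where

open import Defs
open import Data.Bool as Bool using (true)
open import Data.Nat using (ℕ; _≤_; suc; z≤n; s≤s)
open import Data.Nat.Properties using (≤⇒≯)
open import Data.Fin using (Fin; zero; suc) renaming (_<_ to _<ᶠ_; _≤_ to _≤ᶠ_)
open import Data.Fin.Properties using (≤∧≢⇒<; <⇒≢; <-trans; <-asym; suc-injective; ≤-decTotalOrder)
open import Data.Fin.Subset using (Subset; _∩_; ∣_∣; _∈_; _∉_; inside; outside)
open import Data.Fin.Subset.Properties using (x∈p∩q⁻)
open import Data.List using (List; []; _∷_; length; map)
open import Data.List.Properties using (length-map)
open import Data.List.Relation.Unary.All as All using (All; []; _∷_)
import Data.List.Relation.Unary.All.Properties as All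
open import Data.List.Relation.Unary.AllPairs as AllPairs using (AllPairs; []; _∷_)
import Data.List.Relation.Unary.AllPairs.Properties as AllPairs
open import Data.List.Relation.Unary.Linked using (Linked; _∷_)
open import Data.List.Relation.Unary.Unique.Propositional using (Unique)
import Data.List.Relation.Unary.Unique.Propositional.Properties as Unique
import Data.List.Relation.Binary.Permutation.Setoid as Permutation
import Data.List.Relation.Binary.Permutation.Setoid.Properties as PermutationProperties
open import Data.List.Sort using (sortingAlgorithm)
open import Data.List.Sort.Base using (SortingAlgorithm)
open import Data.Vec using ([]; _∷_; here; there)
open import Data.Vec.Properties using ([]=⇒lookup; lookup∘tabulate)
open import Data.Product using (∃₂; _×_; _,_; proj₁; map₁)
open import Data.Sum using (inj₁; inj₂)
open import Function using (_∘_)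
open import Function.Definitions using (Injective)
open import Level using (0ℓ)
open import Relation.Binary using (Rel; Symmetric; Irreflexive)
open import Relation.Binary.PropositionalEquality
open import Relation.Nullary using (¬_; yes; no; contradiction)

elements : ∀ {n} → Subset n → List (Fin n)
elements []            = []
elements (inside  ∷ p) = zero ∷ map suc (elements p)
elements (outside ∷ p) = map suc (elements p)

length-elements : ∀ {n} (p : Subset n) → length (elements p) ≡ ∣ p ∣
length-elements []            = refl
length-elements (inside  ∷ p) = cong suc (trans (length-map suc (elements p)) (length-elements p))
length-elements (outside ∷ p) = trans (length-map suc (elements p)) (length-elements p)

elements-∈ : ∀ {n} (p : Subset n) → All (_∈ p) (elements p)
elements-∈ []            = []
elements-∈ (inside  ∷ p) = here ∷ All.map⁺ (All.map there (elements-∈ p))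
elements-∈ (outside ∷ p) = All.map⁺ (All.map there (elements-∈ p))

elements-unique : ∀ {n} (p : Subset n) → Unique (elements p)
elements-unique []            = []
elements-unique (inside  ∷ p) =
  All.map⁺ (All.universal (λ _ ()) (elements p)) ∷ Unique.map⁺ suc-injective (elements-unique p)
elements-unique (outside ∷ p) = Unique.map⁺ suc-injective (elements-unique p)

module _ {n : ℕ} (G : Graph n) where

  Edge-sym : ∀ {u v} → Edge G u v → Edge G v u
  Edge-sym {u} {v} e = trans (Graph.sym G v u) e

  Edge⇒≢ : ∀ {u v} → Edge G u v → u ≢ v
  Edge⇒≢ {u} e refl with trans (sym e) (Graph.irrefl G u)
  ... | ()

  ∈N⇒Edge : ∀ {x y} → y ∈ N G x → Edge G x y
  ∈N⇒Edge {x} {y} y∈Nx = trans (sym (lookup∘tabulate (Graph.adj G x) y)) ([]=⇒lookup y∈Nx)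

  Walk-length-≥2 : ∀ {u v k} → u ≢ v → ¬ Edge G u v → Walk G u v k → 2 ≤ k
  Walk-length-≥2 u≢v _   []          = contradiction refl u≢v
  Walk-length-≥2 _   ¬uv (uv ∷ [])   = contradiction uv ¬uv
  Walk-length-≥2 _   _   (_ ∷ _ ∷ _) = s≤s (s≤s z≤n)

  module _ {S : Subset n} (gp : GeneralPosition G S) where

    common-neighbours-adjacent : ∀ {x a b} → x ∈ S → a ∈ S → b ∈ S → a ≢ b →
                                 Edge G x a → Edge G x b → Edge G a b
    common-neighbours-adjacent {x} {a} {b} x∈S a∈S b∈S a≢b xa xb with Graph.adj G a b Bool.≟ true
    ... | yes ab = ab
    ... | no ¬ab = contradiction x-between-a-b
                     (gp a b x a∈S b∈S x∈S a≢b (Edge⇒≢ (Edge-sym xb)) (Edge⇒≢ (Edge-sym xa)))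
      where
      x-between-a-b : OnGeodesic G x a b
      x-between-a-b = 1 , 1 , Edge-sym xa ∷ [] , xb ∷ [] , λ _ → Walk-length-≥2 a≢b ¬ab

    neighbourhood-clique : ∀ {x ys} → x ∈ S → Unique ys → All (_∈ N G x ∩ S) ys →
                           AllPairs (Edge G) (x ∷ ys)
    neighbourhood-clique {x} {ys} x∈S ys-unique ys∈ =
      All.map proj₁ neighbours ∷ pairwise ys-unique neighbours
      where
      neighbours : All (λ y → Edge G x y × y ∈ S) ys
      neighbours = All.map (map₁ ∈N⇒Edge ∘ x∈p∩q⁻ (N G x) S) ys∈
      pairwise : ∀ {zs} → Unique zs → All (λ z → Edge G x z × z ∈ S) zs → AllPairs (Edge G) zs
      pairwise []              []                = []
      pairwise (z≢zs ∷ unique) ((xz , z∈S) ∷ nbs) =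
        All.zipWith (λ (z≢w , xw , w∈S) → common-neighbours-adjacent x∈S z∈S w∈S z≢w xz xw) (z≢zs , nbs)
          ∷ pairwise unique nbs

module _ {n : ℕ} where

  NonCrossing : ∀ {ℓ} → Rel (Fin n) ℓ → Set ℓ
  NonCrossing R = ∀ {p q r s} → R p q → R r s → ¬ Cross p q r s

  ordered-chords-cross : ∀ {p q r s : Fin n} → p <ᶠ q → q <ᶠ r → r <ᶠ s → Cross p r q s
  ordered-chords-cross {p} {q} {r} {s} p<q q<r r<s =
    inj₁ (inj₁ (p<q , q<r) , s-outside , ≢-sym (<⇒≢ p<s) , ≢-sym (<⇒≢ r<s))
    where
    p<s : p <ᶠ s
    p<s = <-trans p<q (<-trans q<r r<s)
    s-outside : ¬ Inside p r s
    s-outside (inj₁ (_ , s<r)) = <-asym s<r r<s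
    s-outside (inj₂ (_ , s<p)) = <-asym s<p p<s

  module _ {ℓ} {R : Rel (Fin n) ℓ} (R-sym : Symmetric R) (R-irrefl : Irreflexive _≡_ R)
           (noncrossing : NonCrossing R) where

    sorted-clique-size≤3 : ∀ {ps} → Linked _≤ᶠ_ ps → AllPairs R ps → length ps ≤ 3
    sorted-clique-size≤3 {[]}                _ _ = z≤n
    sorted-clique-size≤3 {_ ∷ []}            _ _ = s≤s z≤n
    sorted-clique-size≤3 {_ ∷ _ ∷ []}        _ _ = s≤s (s≤s z≤n)
    sorted-clique-size≤3 {_ ∷ _ ∷ _ ∷ []}    _ _ = s≤s (s≤s (s≤s z≤n))
    sorted-clique-size≤3 {_ ∷ _ ∷ _ ∷ _ ∷ _} (p≤q ∷ q≤r ∷ r≤s ∷ _)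
      ((pq ∷ pr ∷ _) ∷ (qr ∷ qs ∷ _) ∷ (rs ∷ _) ∷ _) =
      contradiction (ordered-chords-cross (strict p≤q pq) (strict q≤r qr) (strict r≤s rs)) (noncrossing pr qs)
      where
      strict : ∀ {p q} → p ≤ᶠ q → R p q → p <ᶠ q
      strict p≤q pq = ≤∧≢⇒< p≤q (λ p≡q → R-irrefl p≡q pq)

    clique-size≤3 : ∀ {ps} → AllPairs R ps → length ps ≤ 3
    clique-size≤3 {ps} clique =
      subst (_≤ 3) (sym (↭-length ps↭sorted))
        (sorted-clique-size≤3 (sort-↗ ps) (AllPairs-resp-↭ R-sym (resp₂ R) ps↭sorted clique))
      where
      open SortingAlgorithm (sortingAlgorithm (≤-decTotalOrder n)) using (sort; sort-↭ₛ; sort-↗)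
      open Permutation (setoid (Fin n)) using (_↭_; ↭-sym)
      open PermutationProperties (setoid (Fin n))
        using (AllPairs-resp-↭) renaming (xs↭ys⇒|xs|≡|ys| to ↭-length)
      ps↭sorted : ps ↭ sort ps
      ps↭sorted = ↭-sym (sort-↭ₛ ps)

module _ {n : ℕ} (G : Graph n) (pos : Fin n → Fin n) (pos-injective : Injective _≡_ _≡_ pos)
         (noncrossing : ∀ u v w z → Edge G u v → Edge G w z → ¬ Cross (pos u) (pos v) (pos w) (pos z))
         where

  Chord : Rel (Fin n) 0ℓ
  Chord p q = ∃₂ λ u v → pos u ≡ p × pos v ≡ q × Edge G u v

  Chord-sym : Symmetric Chord
  Chord-sym (u , v , refl , refl , uv) = v , u , refl , refl , Edge-sym G uv

  Chord-irrefl : Irreflexive _≡_ Chord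
  Chord-irrefl refl (u , v , refl , pos-v≡pos-u , uv) = Edge⇒≢ G uv (pos-injective (sym pos-v≡pos-u))

  Chord-noncrossing : NonCrossing Chord
  Chord-noncrossing (u , v , refl , refl , uv) (w , z , refl , refl , wz) = noncrossing u v w z uv wz

  outerplane-clique-size≤3 : ∀ {vs} → AllPairs (Edge G) vs → length vs ≤ 3
  outerplane-clique-size≤3 {vs} clique =
    subst (_≤ 3) (length-map pos vs) (clique-size≤3 Chord-sym Chord-irrefl Chord-noncrossing chords)
    where
    chords : AllPairs Chord (map pos vs)
    chords = AllPairs.map⁺ (AllPairs.map (λ {u} {v} uv → u , v , refl , refl , uv) clique)

mainTheorem3 : ∀ {n : ℕ} (G : Graph n) → MaximalOuterplane G →
    (S : Subset n) → GeneralPosition G S →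
    (x : Fin n) → 3 ≤ ∣ N G x ∩ S ∣ → x ∉ S
mainTheorem3 {n} G (pos , pos-injective , noncrossing , _) S gp x 3≤∣N∩S∣ x∈S =
  ≤⇒≯ (outerplane-clique-size≤3 G pos pos-injective noncrossing clique) (s≤s 3≤#neighbours)
  where
  neighbours : List (Fin n)
  neighbours = elements (N G x ∩ S)
  clique : AllPairs (Edge G) (x ∷ neighbours)
  clique = neighbourhood-clique G gp x∈S (elements-unique (N G x ∩ S)) (elements-∈ (N G x ∩ S))
  3≤#neighbours : 3 ≤ length neighbours
  3≤#neighbours = subst (3 ≤_) (sym (length-elements (N G x ∩ S))) 3≤∣N∩S∣
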